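{- Let $p$ be a prime and $a=\sum_{i\ge0}a_ip^i$, $b=\sum_{i\ge0}b_ip^i\in\mathbb Z_p$, $a+b=\sum_{i\ge0}c_ip^i$, with $a_i,b_i,c_i\in\{0,1,\ldots,p-1\}$. Then $c_0\equiv a_0+b_0\pmod p$ and for $t\ge1$, $$c_t\equiv a_t+b_t+\sum_{i=0}^{t-1}\left(\sum_{j=1}^{p-1}\binom{a_i}{j}\binom{b_i}{p-j}\right)\prod_{j=i+1}^{t-1}\binom{a_j+b_j}{p-1}\pmod p.$$ In particular, if $p=2$, then $c_0\equiv a_0+b_0\pmod2$ and for $t\ge1$, $c_t\equiv a_t+b_t+\sum_{i=0}^{t-1}a_ib_i\prod_{j=i+1}^{t-1}(a_j+b_j)\pmod 2$.
   Context: Binomial coefficients are the ordinary ones of non-negative integers; an empty product equals $1$. -}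

module Defs where

open import Data.Nat using (ℕ; zero; suc; _+_; _*_; _^_)
open import Data.Integer as ℤ using (ℤ; +_; _-_)
open import Data.Integer.Divisibility as ℤd using ()

∑< : ℕ → (ℕ → ℕ) → ℕ
∑< zero    f = 0
∑< (suc n) f = ∑< n f + f n

∏from : ℕ → ℕ → (ℕ → ℕ) → ℕ
∏from lo zero    f = 1
∏from lo (suc n) f = ∏from lo n f * f (lo + n)

_≡_[mod_] : ℕ → ℕ → ℕ → Set
x ≡ y [mod m ] = (+ m) ℤd.∣ ((+ x) - (+ y))

-- A p-adic integer is given by its digit sequence (a_i)_{i ≥ 0} with 0 ≤ a_i < p.
IsDigits : ℕ → (ℕ → ℕ) → Set
IsDigits p a = ∀ i → a i Data.Nat.< p
  where import Data.Nat

-- truncation  a mod p^n  =  Σ_{i<n} a_i p^i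
trunc : ℕ → (ℕ → ℕ) → ℕ → ℕ
trunc p a n = ∑< n (λ i → a i * p ^ i)

-- c is the digit sequence of the p-adic sum a + b:  Z_p is the inverse limit of
-- Z/p^n, so c represents a + b iff  c ≡ a + b (mod p^n)  for every n.
IsSumDigits : ℕ → (ℕ → ℕ) → (ℕ → ℕ) → (ℕ → ℕ) → Set
IsSumDigits p a b c = ∀ n → trunc p c n ≡ trunc p a n + trunc p b n [mod p ^ n ]

-- Let e_t be the carry into column t when a and b are added digitwise in base p, so that
-- e_0 = 0, e_{t+1} = ⌊(a_t + b_t + e_t) / p⌋ ∈ {0, 1} and c_t ≡ a_t + b_t + e_t (mod p).
-- For s = a_t + b_t ≤ 2p - 2 one has, modulo p, C(s, p) ≡ [s ≥ p] and C(s, p - 1) ≡ [s = p - 1]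
-- (from absorption, Pascal's rule and Euclid's lemma), and by Vandermonde's identity the inner
-- sum of the statement is C(s, p).  So a carry out of column t is either generated (s ≥ p) or
-- propagated (s = p - 1 and e_t = 1):  e_{t+1} ≡ e_t C(s, p - 1) + C(s, p),  and unrolling this
-- affine recurrence gives the formula.  For p = 2 both binomial coefficients are C(·, 1).
module Submission where

open import Defs
open import Data.Nat
open import Data.Nat.Properties
open import Data.Nat.DivMod
open import Data.Nat.Divisibility
  using (_∣_; divides; ∣-refl; ∣m+n∣m⇒∣n; ∣⇒≤; n∣m*n; n∣m⇒m%n≡0)
open import Data.Nat.Combinatorics
  using (_C_; nCn≡1; nC1≡n; k>n⇒nCk≡0; nCk+nC[k+1]≡[n+1]C[k+1])
open import Data.Nat.Primality using (Prime; euclidsLemma)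
open import Data.Nat.Tactic.RingSolver using (solve-∀)
import Data.Integer as ℤ
import Data.Integer.Properties as ℤ
open import Data.Product using (_×_; _,_)
open import Data.Sum using (inj₁; inj₂)
open import Data.Empty using (⊥-elim)
open import Relation.Binary.Definitions using (tri<; tri≈; tri>)
open import Relation.Binary.Structures using (IsEquivalence)
open import Relation.Binary.PropositionalEquality
open ≡-Reasoning

∑<-suc : ∀ n f → ∑< (suc n) f ≡ f 0 + ∑< n (λ k → f (suc k))
∑<-suc zero    f = sym (+-identityʳ (f 0))
∑<-suc (suc n) f = begin
  ∑< (suc n) f + f (suc n)                  ≡⟨ cong (_+ f (suc n)) (∑<-suc n f) ⟩
  f 0 + ∑< n (λ k → f (suc k)) + f (suc n)  ≡⟨ +-assoc (f 0) _ _ ⟩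
  f 0 + ∑< (suc n) (λ k → f (suc k))        ∎

∑<-zero : ∀ n → ∑< n (λ _ → 0) ≡ 0
∑<-zero zero    = refl
∑<-zero (suc n) = trans (+-identityʳ _) (∑<-zero n)

∑<-cong : ∀ n {f g} → (∀ i → i < n → f i ≡ g i) → ∑< n f ≡ ∑< n g
∑<-cong zero    f≡g = refl
∑<-cong (suc n) f≡g = cong₂ _+_ (∑<-cong n (λ i i<n → f≡g i (m<n⇒m<1+n i<n))) (f≡g n ≤-refl)

∑<-distrib-+ : ∀ n f g → ∑< n (λ i → f i + g i) ≡ ∑< n f + ∑< n g
∑<-distrib-+ zero    f g = refl
∑<-distrib-+ (suc n) f g = begin
  ∑< n (λ i → f i + g i) + (f n + g n)  ≡⟨ cong (_+ (f n + g n)) (∑<-distrib-+ n f g) ⟩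
  ∑< n f + ∑< n g + (f n + g n)         ≡⟨ interchange (∑< n f) (∑< n g) (f n) (g n) ⟩
  ∑< n f + f n + (∑< n g + g n)         ∎
  where
  interchange : ∀ w x y z → w + x + (y + z) ≡ w + y + (x + z)
  interchange = solve-∀

∑<-distribʳ-* : ∀ n f c → ∑< n (λ i → f i * c) ≡ ∑< n f * c
∑<-distribʳ-* zero    f c = refl
∑<-distribʳ-* (suc n) f c =
  trans (cong (_+ f n * c) (∑<-distribʳ-* n f c)) (sym (*-distribʳ-+ c (∑< n f) (f n)))

∏from-cong : ∀ lo n {f g} → (∀ i → f i ≡ g i) → ∏from lo n f ≡ ∏from lo n g
∏from-cong lo zero    f≡g = refl
∏from-cong lo (suc n) f≡g = cong₂ _*_ (∏from-cong lo n f≡g) (f≡g (lo + n))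

affineSolution : (ℕ → ℕ) → (ℕ → ℕ) → ℕ → ℕ
affineSolution G H t = ∑< t (λ i → G i * ∏from (suc i) (t ∸ suc i) H)

affineSolution-suc : ∀ G H t → affineSolution G H (suc t) ≡ affineSolution G H t * H t + G t
affineSolution-suc G H t = begin
  affineSolution G H (suc t)
    ≡⟨ cong₂ _+_ (∑<-cong t extend) (cong (λ n → G t * ∏from (suc t) n H) (n∸n≡0 t)) ⟩
  ∑< t (λ i → G i * ∏from (suc i) (t ∸ suc i) H * H t) + G t * 1
    ≡⟨ cong₂ _+_ (∑<-distribʳ-* t _ (H t)) (*-identityʳ (G t)) ⟩
  affineSolution G H t * H t + G t ∎
  where
  extend : ∀ i → i < t
    → G i * ∏from (suc i) (suc t ∸ suc i) H ≡ G i * ∏from (suc i) (t ∸ suc i) H * H t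
  extend i i<t = begin
    G i * ∏from (suc i) (suc t ∸ suc i) H
      ≡⟨ cong (λ n → G i * ∏from (suc i) n H) (+-∸-assoc 1 i<t) ⟩
    G i * (∏from (suc i) (t ∸ suc i) H * H (suc i + (t ∸ suc i)))
      ≡⟨ cong (λ j → G i * (∏from (suc i) (t ∸ suc i) H * H j)) (m+[n∸m]≡n i<t) ⟩
    G i * (∏from (suc i) (t ∸ suc i) H * H t)
      ≡⟨ *-assoc (G i) _ _ ⟨
    G i * ∏from (suc i) (t ∸ suc i) H * H t ∎

affineSolution-cong : ∀ {G G′ H H′} → (∀ i → G i ≡ G′ i) → (∀ j → H j ≡ H′ j)
  → ∀ t → affineSolution G H t ≡ affineSolution G′ H′ t
affineSolution-cong G≡G′ H≡H′ t =
  ∑<-cong t (λ i _ → cong₂ _*_ (G≡G′ i) (∏from-cong (suc i) (t ∸ suc i) H≡H′))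

pascal : ∀ n k → suc n C suc k ≡ n C k + n C suc k
pascal n k = sym (nCk+nC[k+1]≡[n+1]C[k+1] n k)

vandermonde : ∀ a b n → ∑< (suc n) (λ k → (a C k) * (b C (n ∸ k))) ≡ (a + b) C n
vandermonde zero b n = begin
  ∑< (suc n) (λ k → (0 C k) * (b C (n ∸ k)))  ≡⟨ ∑<-suc n _ ⟩
  1 * (b C n) + ∑< n (λ _ → 0)                ≡⟨ cong₂ _+_ (*-identityˡ (b C n)) (∑<-zero n) ⟩
  b C n + 0                                   ≡⟨ +-identityʳ _ ⟩
  b C n                                       ∎
vandermonde (suc a) b zero    = refl
vandermonde (suc a) b (suc n) = begin
  ∑< (suc (suc n)) (λ k → (suc a C k) * (b C (suc n ∸ k)))
    ≡⟨ ∑<-suc (suc n) _ ⟩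
  1 * (b C suc n) + ∑< (suc n) (λ k → (suc a C suc k) * (b C (n ∸ k)))
    ≡⟨ cong (1 * (b C suc n) +_) (∑<-cong (suc n) (λ k _ → split k)) ⟩
  1 * (b C suc n) + ∑< (suc n) (λ k → (a C k) * (b C (n ∸ k)) + (a C suc k) * (b C (n ∸ k)))
    ≡⟨ cong (1 * (b C suc n) +_) (∑<-distrib-+ (suc n) _ _) ⟩
  1 * (b C suc n) + (V n + S)
    ≡⟨ +-rotate (1 * (b C suc n)) (V n) S ⟩
  V n + (1 * (b C suc n) + S)
    ≡⟨ cong (V n +_) (∑<-suc (suc n) (λ k → (a C k) * (b C (suc n ∸ k)))) ⟨
  V n + V (suc n)
    ≡⟨ cong₂ _+_ (vandermonde a b n) (vandermonde a b (suc n)) ⟩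
  (a + b) C n + (a + b) C suc n
    ≡⟨ pascal (a + b) n ⟨
  suc (a + b) C suc n ∎
  where
  V : ℕ → ℕ
  V m = ∑< (suc m) (λ k → (a C k) * (b C (m ∸ k)))
  S : ℕ
  S = ∑< (suc n) (λ k → (a C suc k) * (b C (n ∸ k)))
  split : ∀ k → (suc a C suc k) * (b C (n ∸ k))
                ≡ (a C k) * (b C (n ∸ k)) + (a C suc k) * (b C (n ∸ k))
  split k = trans (cong (_* (b C (n ∸ k))) (pascal a k))
                  (*-distribʳ-+ (b C (n ∸ k)) (a C k) (a C suc k))
  +-rotate : ∀ x y z → x + (y + z) ≡ y + (x + z)
  +-rotate = solve-∀

vandermonde-interior : ∀ {a b n} → a ≤ n → b ≤ n
  → ∑< n (λ k → (a C suc k) * (b C (n ∸ k))) ≡ (a + b) C suc n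
vandermonde-interior {a} {b} {n} a≤n b≤n = sym (begin
  (a + b) C suc n           ≡⟨ vandermonde a b (suc n) ⟨
  ∑< (suc n) f + f (suc n)  ≡⟨ cong (_+ f (suc n)) (∑<-suc n f) ⟩
  f 0 + ∑< n g + f (suc n)  ≡⟨ cong₂ (λ x y → x + ∑< n g + y) first last ⟩
  0 + ∑< n g + 0            ≡⟨ +-identityʳ _ ⟩
  ∑< n g                    ∎)
  where
  f g : ℕ → ℕ
  f k = (a C k) * (b C (suc n ∸ k))
  g k = (a C suc k) * (b C (n ∸ k))
  first : f 0 ≡ 0
  first = trans (*-identityˡ (b C suc n)) (k>n⇒nCk≡0 (s≤s b≤n))
  last : f (suc n) ≡ 0
  last = cong (_* (b C (n ∸ n))) (k>n⇒nCk≡0 (s≤s a≤n))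

absorption : ∀ n k → suc k * (suc n C suc k) ≡ suc n * (n C k)
absorption n zero = begin
  1 * (suc n C 1)  ≡⟨ *-identityˡ _ ⟩
  suc n C 1        ≡⟨ nC1≡n (suc n) ⟩
  suc n            ≡⟨ *-identityʳ (suc n) ⟨
  suc n * 1        ∎
absorption zero    (suc k) = *-zeroʳ (suc (suc k))
absorption (suc n) (suc k) = begin
  suc (suc k) * (suc (suc n) C suc (suc k))
    ≡⟨ cong (suc (suc k) *_) (pascal (suc n) (suc k)) ⟩
  suc (suc k) * (X + Y)
    ≡⟨ *-distribˡ-+ (suc (suc k)) X Y ⟩
  X + suc k * X + suc (suc k) * Y
    ≡⟨ cong₂ (λ u v → X + u + v) (absorption n k) (absorption n (suc k)) ⟩
  X + suc n * (n C k) + suc n * (n C suc k)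
    ≡⟨ +-assoc X _ _ ⟩
  X + (suc n * (n C k) + suc n * (n C suc k))
    ≡⟨ cong (X +_) (*-distribˡ-+ (suc n) (n C k) (n C suc k)) ⟨
  X + suc n * (n C k + n C suc k)
    ≡⟨ cong (λ z → X + suc n * z) (pascal n k) ⟨
  suc (suc n) * X ∎
  where
  X Y : ℕ
  X = suc n C suc k
  Y = suc n C suc (suc k)

∣[+x]-[+y]∣≡∣x-y∣ : ∀ x y → ℤ.∣ ℤ.+ x ℤ.- ℤ.+ y ∣ ≡ ∣ x - y ∣
∣[+x]-[+y]∣≡∣x-y∣ x y with ≤-total x y
... | inj₁ x≤y = begin
  ℤ.∣ ℤ.+ x ℤ.- ℤ.+ y ∣  ≡⟨ cong ℤ.∣_∣ (ℤ.[+m]-[+n]≡m⊖n x y) ⟩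
  ℤ.∣ x ℤ.⊖ y ∣          ≡⟨ ℤ.∣⊖∣-≤ x≤y ⟩
  y ∸ x                  ≡⟨ m≤n⇒∣m-n∣≡n∸m x≤y ⟨
  ∣ x - y ∣              ∎
... | inj₂ y≤x = begin
  ℤ.∣ ℤ.+ x ℤ.- ℤ.+ y ∣  ≡⟨ cong ℤ.∣_∣ (ℤ.[+m]-[+n]≡m⊖n x y) ⟩
  ℤ.∣ x ℤ.⊖ y ∣          ≡⟨ ℤ.∣m⊖n∣≡∣n⊖m∣ x y ⟩
  ℤ.∣ y ℤ.⊖ x ∣          ≡⟨ ℤ.∣⊖∣-≤ y≤x ⟩
  x ∸ y                  ≡⟨ m≤n⇒∣n-m∣≡n∸m y≤x ⟨
  ∣ x - y ∣              ∎

module _ {m : ℕ} .{{_ : NonZero m}} where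

  ∣∸⇒%≡ : ∀ {x y} → y ≤ x → m ∣ x ∸ y → x % m ≡ y % m
  ∣∸⇒%≡ {x} {y} y≤x m∣x∸y = begin
    x % m              ≡⟨ cong (_% m) (m+[n∸m]≡n y≤x) ⟨
    (y + (x ∸ y)) % m  ≡⟨ %-remove-+ʳ y m∣x∸y ⟩
    y % m              ∎

  %≡⇒∣∸ : ∀ {x y} → y ≤ x → x % m ≡ y % m → m ∣ x ∸ y
  %≡⇒∣∸ {x} {y} y≤x x%m≡y%m = divides (x / m ∸ y / m) (begin
    x ∸ y                                    ≡⟨ cong₂ _∸_ (m≡m%n+[m/n]*n x m) (m≡m%n+[m/n]*n y m) ⟩
    x % m + x / m * m ∸ (y % m + y / m * m)  ≡⟨ cong (λ r → x % m + x / m * m ∸ (r + y / m * m)) x%m≡y%m ⟨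
    x % m + x / m * m ∸ (x % m + y / m * m)  ≡⟨ [m+n]∸[m+o]≡n∸o (x % m) _ _ ⟩
    x / m * m ∸ y / m * m                    ≡⟨ *-distribʳ-∸ m (x / m) (y / m) ⟨
    (x / m ∸ y / m) * m                      ∎)

  [mod]⇒%≡ : ∀ x y → x ≡ y [mod m ] → x % m ≡ y % m
  [mod]⇒%≡ x y x≡y with subst (m ∣_) (∣[+x]-[+y]∣≡∣x-y∣ x y) x≡y | ≤-total x y
  ... | m∣∣x-y∣ | inj₁ x≤y = sym (∣∸⇒%≡ x≤y (subst (m ∣_) (m≤n⇒∣m-n∣≡n∸m x≤y) m∣∣x-y∣))
  ... | m∣∣x-y∣ | inj₂ y≤x = ∣∸⇒%≡ y≤x (subst (m ∣_) (m≤n⇒∣n-m∣≡n∸m y≤x) m∣∣x-y∣)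

  %≡⇒[mod] : ∀ x y → x % m ≡ y % m → x ≡ y [mod m ]
  %≡⇒[mod] x y x%m≡y%m = subst (m ∣_) (sym (∣[+x]-[+y]∣≡∣x-y∣ x y)) m∣∣x-y∣
    where
    m∣∣x-y∣ : m ∣ ∣ x - y ∣
    m∣∣x-y∣ with ≤-total x y
    ... | inj₁ x≤y = subst (m ∣_) (sym (m≤n⇒∣m-n∣≡n∸m x≤y)) (%≡⇒∣∸ x≤y (sym x%m≡y%m))
    ... | inj₂ y≤x = subst (m ∣_) (sym (m≤n⇒∣n-m∣≡n∸m y≤x)) (%≡⇒∣∸ y≤x x%m≡y%m)

module Modulo (m : ℕ) .{{_ : NonZero m}} where

  -- A record rather than a function, so that x and y can be inferred from x ≈ y.
  infix 4 _≈_
  record _≈_ (x y : ℕ) : Set where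
    constructor mk≈
    field
      %-≡ : x % m ≡ y % m

  open _≈_ public

  ≈-reflexive : ∀ {x y} → x ≡ y → x ≈ y
  ≈-reflexive x≡y = mk≈ (cong (_% m) x≡y)

  ≈-isEquivalence : IsEquivalence _≈_
  ≈-isEquivalence = record
    { refl  = mk≈ refl
    ; sym   = λ x≈y → mk≈ (sym (%-≡ x≈y))
    ; trans = λ x≈y y≈z → mk≈ (trans (%-≡ x≈y) (%-≡ y≈z))
    }

  open IsEquivalence ≈-isEquivalence public
    using () renaming (refl to ≈-refl; sym to ≈-sym; trans to ≈-trans)

  +-cong-≈ : ∀ {x x′ y y′} → x ≈ x′ → y ≈ y′ → x + y ≈ x′ + y′
  +-cong-≈ {x} {x′} {y} {y′} (mk≈ x≈x′) (mk≈ y≈y′) = mk≈ (begin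
    (x + y) % m              ≡⟨ %-distribˡ-+ x y m ⟩
    (x % m + y % m) % m      ≡⟨ cong₂ (λ u v → (u + v) % m) x≈x′ y≈y′ ⟩
    (x′ % m + y′ % m) % m    ≡⟨ %-distribˡ-+ x′ y′ m ⟨
    (x′ + y′) % m            ∎)

  *-cong-≈ : ∀ {x x′ y y′} → x ≈ x′ → y ≈ y′ → x * y ≈ x′ * y′
  *-cong-≈ {x} {x′} {y} {y′} (mk≈ x≈x′) (mk≈ y≈y′) = mk≈ (begin
    (x * y) % m              ≡⟨ %-distribˡ-* x y m ⟩
    (x % m * (y % m)) % m    ≡⟨ cong₂ (λ u v → (u * v) % m) x≈x′ y≈y′ ⟩
    (x′ % m * (y′ % m)) % m  ≡⟨ %-distribˡ-* x′ y′ m ⟨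
    (x′ * y′) % m            ∎)

  ∣⇒≈0 : ∀ {x} → m ∣ x → x ≈ 0
  ∣⇒≈0 {x} m∣x = mk≈ (trans (n∣m⇒m%n≡0 x m m∣x) (sym (m<n⇒m%n≡m (>-nonZero⁻¹ m))))

  x%m≈x : ∀ x → x % m ≈ x
  x%m≈x x = mk≈ (m%n%n≡m%n x m)

  ≈⇒[mod] : ∀ {x y} → x ≈ y → x ≡ y [mod m ]
  ≈⇒[mod] {x} {y} (mk≈ x%m≡y%m) = %≡⇒[mod] x y x%m≡y%m

m<n⇒m+e<1+n : ∀ {m n e} → m < n → e ≤ 1 → m + e < suc n
m<n⇒m+e<1+n {m} {n} m<n e≤1 = s≤s (≤-trans (+-monoʳ-≤ m e≤1) (subst (_≤ n) (+-comm 1 m) m<n))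

module _ {q : ℕ} (p-prime : Prime (suc q)) where

  open Modulo (suc q)

  p∣[p+r]C[p∸1] : ∀ {r} → r < q → suc q ∣ (suc q + r) C q
  p∣[p+r]C[p∸1] {r} r<q with euclidsLemma (suc (suc q + r)) ((suc q + r) C q) p-prime
    (divides (suc (suc q + r) C suc q) (trans (sym (absorption (suc q + r) q)) (*-comm (suc q) _)))
  ... | inj₂ p∣C     = p∣C
  ... | inj₁ p∣p+1+r = ⊥-elim (<⇒≱ r<q (≤-pred (∣⇒≤ p∣1+r)))
    where
    p∣1+r : suc q ∣ suc r
    p∣1+r = ∣m+n∣m⇒∣n (subst (suc q ∣_) (sym (+-suc (suc q) r)) p∣p+1+r) ∣-refl

  [p+r]Cp≈1 : ∀ {r} → r < suc q → (suc q + r) C suc q ≈ 1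
  [p+r]Cp≈1 {zero}  _     =
    ≈-reflexive (trans (cong (_C suc q) (+-identityʳ (suc q))) (nCn≡1 (suc q)))
  [p+r]Cp≈1 {suc r} 1+r<p = ≈-trans (≈-reflexive unfold)
    (+-cong-≈ (∣⇒≈0 (p∣[p+r]C[p∸1] r<q)) ([p+r]Cp≈1 (m<n⇒m<1+n r<q)))
    where
    r<q : r < q
    r<q = ≤-pred 1+r<p
    unfold : (suc q + suc r) C suc q ≡ (suc q + r) C q + (suc q + r) C suc q
    unfold = trans (cong (_C suc q) (+-suc (suc q) r)) (pascal (suc q + r) q)

  [s+e]/p≈e*sC[p∸1]+sCp : ∀ {s e} → s < suc q + q → e ≤ 1
    → (s + e) / suc q ≈ e * (s C q) + s C suc q
  [s+e]/p≈e*sC[p∸1]+sCp {s} {e} s<p+q e≤1 with <-cmp s q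
  ... | tri< s<q _ _ = ≈-reflexive (begin
    (s + e) / suc q            ≡⟨ m<n⇒m/n≡0 (m<n⇒m+e<1+n s<q e≤1) ⟩
    0                          ≡⟨ trans (+-identityʳ (e * 0)) (*-zeroʳ e) ⟨
    e * 0 + 0                  ≡⟨ cong₂ (λ x y → e * x + y) (k>n⇒nCk≡0 s<q) (k>n⇒nCk≡0 (m<n⇒m<1+n s<q)) ⟨
    e * (s C q) + s C suc q    ∎)
  ... | tri≈ _ refl _ with e≤1
  ...   | z≤n = ≈-reflexive (begin
    (s + 0) / suc s            ≡⟨ m<n⇒m/n≡0 (s≤s (≤-reflexive (+-identityʳ s))) ⟩
    0                          ≡⟨ k>n⇒nCk≡0 (n<1+n s) ⟨
    0 * (s C s) + s C suc s    ∎)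
  ...   | s≤s z≤n = ≈-reflexive (begin
    (s + 1) / suc s            ≡⟨ cong (_/ suc s) (+-comm s 1) ⟩
    suc s / suc s              ≡⟨ n/n≡1 (suc s) ⟩
    1 + 0                      ≡⟨ cong₂ _+_ (trans (*-identityˡ (s C s)) (nCn≡1 s)) (k>n⇒nCk≡0 (n<1+n s)) ⟨
    1 * (s C s) + s C suc s    ∎)
  [s+e]/p≈e*sC[p∸1]+sCp {s} {e} s<p+q e≤1 | tri> _ _ q<s =
    subst (λ s → (s + e) / suc q ≈ e * (s C q) + s C suc q) (m+[n∸m]≡n q<s) (overflow r<q)
    where
    r<q : s ∸ suc q < q
    r<q = subst (s ∸ suc q <_) (m+n∸m≡n (suc q) q) (∸-monoˡ-< s<p+q q<s)
    overflow : ∀ {r} → r < q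
      → (suc q + r + e) / suc q ≈ e * ((suc q + r) C q) + (suc q + r) C suc q
    overflow {r} r<q = ≈-trans (≈-reflexive carry≡1) (≈-sym (≈-trans
      (+-cong-≈ (*-cong-≈ (≈-refl {e}) (∣⇒≈0 (p∣[p+r]C[p∸1] r<q))) ([p+r]Cp≈1 (m<n⇒m<1+n r<q)))
      (≈-reflexive (cong (_+ 1) (*-zeroʳ e)))))
      where
      carry≡1 : (suc q + r + e) / suc q ≡ 1
      carry≡1 = begin
        (suc q + r + e) / suc q            ≡⟨ cong (_/ suc q) (+-assoc (suc q) r e) ⟩
        (suc q + (r + e)) / suc q          ≡⟨ m/n≡1+[m∸n]/n (m≤m+n (suc q) (r + e)) ⟩
        1 + (suc q + (r + e) ∸ suc q) / suc q  ≡⟨ cong (λ x → 1 + x / suc q) (m+n∸m≡n (suc q) (r + e)) ⟩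
        1 + (r + e) / suc q                ≡⟨ cong (1 +_) (m<n⇒m/n≡0 (m<n⇒m+e<1+n r<q e≤1)) ⟩
        1                                  ∎

trunc-< : ∀ {p f} → IsDigits p f → ∀ n → trunc p f n < p ^ n
trunc-< f<p zero    = s≤s z≤n
trunc-< {p} {f} f<p (suc n) =
  ≤-trans (+-monoˡ-≤ (f n * p ^ n) (trunc-< f<p n)) (*-monoˡ-≤ (p ^ n) (f<p n))

trunc-injective : ∀ {p f g} .{{_ : NonZero p}}
  → (∀ n → trunc p f n ≡ trunc p g n) → ∀ t → f t ≡ g t
trunc-injective {p} {f} {g} f≡g t = *-cancelʳ-≡ (f t) (g t) (p ^ t) {{m^n≢0 p t}}
  (+-cancelˡ-≡ (trunc p f t) _ _ (trans (f≡g (suc t)) (cong (_+ g t * p ^ t) (sym (f≡g t)))))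

x+y+e<2p : ∀ {p x y e} → x < p → y < p → e ≤ 1 → x + y + e < 2 * p
x+y+e<2p {p} {x} {y} {e} x<p y<p e≤1 = subst (x + y + e <_) (cong (p +_) (sym (+-identityʳ p)))
  (≤-trans (s≤s x+y+e≤x+[1+y]) (+-mono-<-≤ x<p y<p))
  where
  x+y+e≤x+[1+y] : x + y + e ≤ x + suc y
  x+y+e≤x+[1+y] = ≤-trans (+-monoʳ-≤ (x + y) e≤1)
                          (≤-reflexive (trans (+-assoc x y 1) (cong (x +_) (+-comm y 1))))

module Carries (p : ℕ) .{{_ : NonZero p}} (a b : ℕ → ℕ) where

  carry : ℕ → ℕ
  carry zero    = 0
  carry (suc t) = (a t + b t + carry t) / p

  sumDigit : ℕ → ℕ
  sumDigit t = (a t + b t + carry t) % p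

  trunc-sumDigit : ∀ n → trunc p sumDigit n + carry n * p ^ n ≡ trunc p a n + trunc p b n
  trunc-sumDigit zero    = refl
  trunc-sumDigit (suc n) = begin
    S + sumDigit n * P + carry (suc n) * (p * P)
      ≡⟨ regroup S (sumDigit n) (carry (suc n)) p P ⟩
    S + (sumDigit n + carry (suc n) * p) * P
      ≡⟨ cong (λ x → S + x * P) (m≡m%n+[m/n]*n (a n + b n + carry n) p) ⟨
    S + (a n + b n + carry n) * P
      ≡⟨ expand S (a n) (b n) (carry n) P ⟩
    S + carry n * P + a n * P + b n * P
      ≡⟨ cong (λ x → x + a n * P + b n * P) (trunc-sumDigit n) ⟩
    trunc p a n + trunc p b n + a n * P + b n * P
      ≡⟨ interchange (trunc p a n) (trunc p b n) (a n * P) (b n * P) ⟩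
    trunc p a n + a n * P + (trunc p b n + b n * P) ∎
    where
    S P : ℕ
    S = trunc p sumDigit n
    P = p ^ n
    regroup : ∀ s d c p P → s + d * P + c * (p * P) ≡ s + (d + c * p) * P
    regroup = solve-∀
    expand : ∀ s x y c P → s + (x + y + c) * P ≡ s + c * P + x * P + y * P
    expand = solve-∀
    interchange : ∀ w x y z → w + x + y + z ≡ w + y + (x + z)
    interchange = solve-∀

  carry≤1 : IsDigits p a → IsDigits p b → ∀ t → carry t ≤ 1
  carry≤1 a<p b<p zero    = z≤n
  carry≤1 a<p b<p (suc t) = ≤-pred (m<n*o⇒m/o<n (x+y+e<2p (a<p t) (b<p t) (carry≤1 a<p b<p t)))

  sumDigit<p : IsDigits p sumDigit
  sumDigit<p t = m%n<n _ p

  c≡sumDigit : ∀ {c} → IsDigits p c → IsSumDigits p a b c → ∀ t → c t ≡ sumDigit t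
  c≡sumDigit {c} c<p c≡a+b = trunc-injective trunc-c≡trunc-sumDigit
    where
    trunc-c≡trunc-sumDigit : ∀ n → trunc p c n ≡ trunc p sumDigit n
    trunc-c≡trunc-sumDigit n = begin
      trunc p c n                      ≡⟨ m<n⇒m%n≡m (trunc-< c<p n) ⟨
      trunc p c n % P                  ≡⟨ [mod]⇒%≡ _ _ (c≡a+b n) ⟩
      (trunc p a n + trunc p b n) % P  ≡⟨ cong (_% P) (trunc-sumDigit n) ⟨
      (S + carry n * P) % P            ≡⟨ %-remove-+ʳ S (n∣m*n (carry n) {P}) ⟩
      S % P                            ≡⟨ m<n⇒m%n≡m (trunc-< sumDigit<p n) ⟩
      S                                ∎
      where
      S P : ℕ
      S = trunc p sumDigit n
      P = p ^ n
      instance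
        P≢0 : NonZero P
        P≢0 = m^n≢0 p n

carryGenerate : ℕ → ℕ → ℕ → ℕ
carryGenerate p x y = ∑< (p ∸ 1) (λ k → (x C suc k) * (y C (p ∸ suc k)))

carryPropagate : ℕ → ℕ → ℕ
carryPropagate p s = s C (p ∸ 1)

module _ {q : ℕ} (p-prime : Prime (suc q)) {a b : ℕ → ℕ}
         (a<p : IsDigits (suc q) a) (b<p : IsDigits (suc q) b) where

  open Modulo (suc q)
  open Carries (suc q) a b

  private
    G H : ℕ → ℕ
    G i = carryGenerate (suc q) (a i) (b i)
    H j = carryPropagate (suc q) (a j + b j)

  carry≈affineSolution : ∀ t → carry t ≈ affineSolution G H t
  carry≈affineSolution zero    = ≈-refl
  carry≈affineSolution (suc t) = ≈-trans
    ([s+e]/p≈e*sC[p∸1]+sCp p-prime (+-mono-≤ (a<p t) (≤-pred (b<p t))) (carry≤1 a<p b<p t))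
    (≈-trans (+-cong-≈ (*-cong-≈ (carry≈affineSolution t) ≈-refl) (≈-reflexive (sym G≡C)))
             (≈-reflexive (sym (affineSolution-suc G H t))))
    where
    G≡C : G t ≡ (a t + b t) C suc q
    G≡C = vandermonde-interior (≤-pred (a<p t)) (≤-pred (b<p t))

  sumDigit≈ : ∀ {c} → IsDigits (suc q) c → IsSumDigits (suc q) a b c
    → ∀ t → c t ≈ a t + b t + affineSolution G H t
  sumDigit≈ c<p c≡a+b t = ≈-trans (≈-trans (≈-reflexive (c≡sumDigit c<p c≡a+b t)) (x%m≈x _))
                                  (+-cong-≈ ≈-refl (carry≈affineSolution t))

affineSolution-binary : ∀ (a b : ℕ → ℕ) t
  → affineSolution (λ i → carryGenerate 2 (a i) (b i)) (λ j → carryPropagate 2 (a j + b j)) t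
  ≡ affineSolution (λ i → a i * b i) (λ j → a j + b j) t
affineSolution-binary a b =
  affineSolution-cong (λ i → cong₂ _*_ (nC1≡n (a i)) (nC1≡n (b i))) (λ j → nC1≡n (a j + b j))

binaryFormula : ∀ {q} {a b c : ℕ → ℕ} → suc q ≡ 2
  → (∀ t → Modulo._≈_ (suc q) (c t)
             (a t + b t + affineSolution (λ i → carryGenerate (suc q) (a i) (b i))
                                         (λ j → carryPropagate (suc q) (a j + b j)) t))
  → ∀ t → Modulo._≈_ 2 (c t) (a t + b t + affineSolution (λ i → a i * b i) (λ j → a j + b j) t)
binaryFormula {a = a} {b} refl formula t =
  ≈-trans (formula t) (≈-reflexive (cong (a t + b t +_) (affineSolution-binary a b t)))
  where open Modulo 2

digit-congruences : ∀ m .{{_ : NonZero m}} (a b G H : ℕ → ℕ) {c : ℕ → ℕ}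
  → (∀ t → Modulo._≈_ m (c t) (a t + b t + affineSolution G H t))
  → (c 0 ≡ a 0 + b 0 [mod m ]) × (∀ t → t ≥ 1 → c t ≡ a t + b t + affineSolution G H t [mod m ])
digit-congruences m a b G H formula =
  ≈⇒[mod] (≈-trans (formula 0) (≈-reflexive (+-identityʳ _))) , λ t _ → ≈⇒[mod] (formula t)
  where open Modulo m

corollary2p4 : (p : ℕ) → Prime p → (a b c : ℕ → ℕ)
    → IsDigits p a → IsDigits p b → IsDigits p c → IsSumDigits p a b c
    → (c 0 ≡ a 0 + b 0 [mod p ])
      × (∀ t → t ≥ 1 → c t ≡ a t + b t + ∑< t (λ i → ∑< (p ∸ 1) (λ k → (a i C (suc k)) * (b i C (p ∸ suc k))) * ∏from (suc i) (t ∸ suc i) (λ j → (a j + b j) C (p ∸ 1))) [mod p ])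
      × (p ≡ 2 → (c 0 ≡ a 0 + b 0 [mod 2 ]) × (∀ t → t ≥ 1 → c t ≡ a t + b t + ∑< t (λ i → a i * b i * ∏from (suc i) (t ∸ suc i) (λ j → a j + b j)) [mod 2 ]))
corollary2p4 zero    ()
corollary2p4 (suc q) p-prime a b c a<p b<p c<p c≡a+b =
  let digit₀ , digitₜ = digit-congruences (suc q) a b G H formula
  in  digit₀ , digitₜ , λ p≡2 →
      digit-congruences 2 a b (λ i → a i * b i) (λ j → a j + b j) (binaryFormula {a = a} {b} p≡2 formula)
  where
  open Modulo (suc q)
  G H : ℕ → ℕ
  G i = carryGenerate (suc q) (a i) (b i)
  H j = carryPropagate (suc q) (a j + b j)
  formula : ∀ t → c t ≈ a t + b t + affineSolution G H t
  formula = sumDigit≈ p-prime a<p b<p c<p c≡a+b
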